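{- Let $(\mathbf o;\mathbf f_1,\mathbf f_2)$ be an integer frame splitting an integer slope $Q$ with vertices $\mathbf v_0,\dots,\mathbf v_N$ and edge set $E$, and suppose all vertices of $Q$ belong to a proper sublattice $\Gamma$ of $\mathbb{Z}^2$. Then $\hat\pi(E)\ge1$.
   Context: An integer frame is $(\mathbf o;\mathbf f_1,\mathbf f_2)$ with $\mathbf o\in\mathbb{Z}^2$ and $(\mathbf f_1,\mathbf f_2)$ a basis of $\mathbb{Z}^2$. $Q$ is an integer slope w.r.t. $(\mathbf f_1,\mathbf f_2)$: vertices $\mathbf v_0,\dots,\mathbf v_N\in\mathbb{Z}^2$ with $\mathbf a_i=\mathbf v_i-\mathbf v_{i-1}=a_{i1}\mathbf f_1+a_{i2}\mathbf f_2$, $a_{i1}>0,a_{i2}<0$ ($1\le i\le N$), $a_{i1}a_{i+1,2}-a_{i+1,1}a_{i2}>0$ ($1\le i\le N-1$); edges $\varepsilon_i=[\mathbf v_{i-1},\mathbf v_i]$, $E=\{\varepsilon_1,\dots,\varepsilon_N\}$. Write $\mathbf v_i-\mathbf o=v_{i1}\mathbf f_1+v_{i2}\mathbf f_2$. The frame splits $Q$: $v_{01}<0$, $v_{02}>0$, $v_{N1}>0$, $v_{N2}<0$, and some point $\mathbf o+\lambda_1\mathbf f_1+\lambda_2\mathbf f_2\in Q$ has $\lambda_1,\lambda_2>0$. With $x^+=\max(x,0)$, set $\pi_1(\varepsilon_i)=v_{i1}^+-v_{i-1,1}^+$, $\pi_2(\varepsilon_i)=v_{i-1,2}^+-v_{i2}^+$,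 $\hat\pi(\varepsilon_i)=\pi_1(\varepsilon_i)+\pi_2(\varepsilon_i)-2$, and $\hat\pi(E)=\sum_{i=1}^N\hat\pi(\varepsilon_i)$. A proper sublattice of $\mathbb{Z}^2$ is a subgroup $A\mathbb{Z}^2\neq\mathbb{Z}^2$ with $A$ an integer matrix, $\det A\ne0$. -}

module Defs where

open import Data.Nat using (ℕ; zero; suc)
open import Data.Integer using (ℤ; +_; _+_; _-_; _*_; _⊔_; _<_; _≤_)
open import Data.Product using (_×_; _,_; proj₁; proj₂; ∃; ∃₂; Σ)
open import Relation.Binary.PropositionalEquality using (_≡_)
open import Relation.Nullary using (¬_)
import Data.Rational as ℚ

ℤ² : Set
ℤ² = ℤ × ℤ

_+v_ : ℤ² → ℤ² → ℤ²
(a , b) +v (c , d) = (a + c , b + d)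

_•_ : ℤ → ℤ² → ℤ²
k • (a , b) = (k * a , k * b)

IsBasis : ℤ² → ℤ² → Set
IsBasis f₁ f₂ =
  (∀ w → ∃₂ λ a b → w ≡ (a • f₁) +v (b • f₂)) ×
  (∀ a b a' b' → (a • f₁) +v (b • f₂) ≡ (a' • f₁) +v (b' • f₂) → a ≡ a' × b ≡ b')

record Mat2 : Set where
  constructor mat
  field m11 m12 m21 m22 : ℤ

det : Mat2 → ℤ
det (mat a b c d) = a * d - b * c

_·_ : Mat2 → ℤ² → ℤ²
mat a b c d · (x , y) = (a * x + b * y , c * x + d * y)

_∈Lat_ : ℤ² → Mat2 → Set
w ∈Lat A = ∃ λ x → w ≡ A · x

ProperSublattice : Mat2 → Set
ProperSublattice A = ¬ (det A ≡ + 0) × ∃ λ w → ¬ (w ∈Lat A)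

_⁺ : ℤ → ℤ
x ⁺ = x ⊔ + 0

sum1 : ℕ → (ℕ → ℤ) → ℤ
sum1 zero g = + 0
sum1 (suc n) g = sum1 n g + g (suc n)

-- edge projections, given frame coordinates c₁ c₂ of the vertices (edge i = [v_{i-1}, v_i], i ≥ 1)
π₁ : (ℕ → ℤ) → ℕ → ℤ
π₁ c₁ zero = + 0
π₁ c₁ (suc i) = (c₁ (suc i)) ⁺ - (c₁ i) ⁺

π₂ : (ℕ → ℤ) → ℕ → ℤ
π₂ c₂ zero = + 0
π₂ c₂ (suc i) = (c₂ i) ⁺ - (c₂ (suc i)) ⁺

π̂ : (ℕ → ℤ) → (ℕ → ℤ) → ℕ → ℤ
π̂ c₁ c₂ i = π₁ c₁ i + π₂ c₂ i - + 2

π̂E : ℕ → (ℕ → ℤ) → (ℕ → ℤ) → ℤ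
π̂E N c₁ c₂ = sum1 N (π̂ c₁ c₂)

-- Q (vertices v 0..N, frame coordinates c₁ c₂) is an integer slope w.r.t. the frame basis:
-- a_{i1} > 0, a_{i2} < 0 for 1 ≤ i ≤ N, and a_{i1} a_{i+1,2} - a_{i+1,1} a_{i2} > 0 for 1 ≤ i ≤ N-1
IsIntegerSlope : ℕ → (ℕ → ℤ) → (ℕ → ℤ) → Set
IsIntegerSlope N c₁ c₂ =
  (∀ i → i Data.Nat.< N → c₁ i < c₁ (suc i) × c₂ (suc i) < c₂ i) ×
  (∀ i → suc i Data.Nat.< N →
     + 0 < (c₁ (suc i) - c₁ i) * (c₂ (suc (suc i)) - c₂ (suc i))
           - (c₁ (suc (suc i)) - c₁ (suc i)) * (c₂ (suc i) - c₂ i))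

-- the frame splits Q: v_{01} < 0, v_{02} > 0, v_{N1} > 0, v_{N2} < 0, and some point
-- o + λ₁ f₁ + λ₂ f₂ of Q (on some edge [v_i, v_{i+1}], parameter t ∈ [0,1]) has λ₁, λ₂ > 0
Splits : ℕ → (ℕ → ℤ) → (ℕ → ℤ) → Set
Splits N c₁ c₂ =
  c₁ 0 < + 0 × + 0 < c₂ 0 × + 0 < c₁ N × c₂ N < + 0 ×
  Σ ℕ λ i → i Data.Nat.< N × Σ ℚ.ℚ λ t → ℚ.0ℚ ℚ.≤ t × t ℚ.≤ ℚ.1ℚ ×
    (ℚ.0ℚ ℚ.< (c₁ i ℚ./ 1) ℚ.+ t ℚ.* ((c₁ (suc i) - c₁ i) ℚ./ 1)) ×
    (ℚ.0ℚ ℚ.< (c₂ i ℚ./ 1) ℚ.+ t ℚ.* ((c₂ (suc i) - c₂ i) ℚ./ 1))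

module Submission where

-- Write c₁, c₂ as x, y. The edge vectors (aₖ, -bₖ) have aₖ, bₖ ≥ 1 and, the vertices lying in a
-- proper sublattice, consecutive determinants a₍ₖ₊₁₎bₖ - aₖb₍ₖ₊₁₎ ≥ 2; after telescoping,
-- π̂(E) = x_N + y₀ - 2N. Splitting this at the edge j that meets the open quadrant, the part
-- before j is Lⱼ = Σ_{k<j} (bₖ - 2) and the part after j is Rⱼ₊₁ = Σ_{k>j} (aₖ - 2). Induction along
-- the slope, using only the determinant bound, gives 2bⱼLⱼ + aⱼ + bⱼ ≥ 2 and symmetrically
-- 2aⱼRⱼ₊₁ + aⱼ + bⱼ ≥ 2, so the deficit accumulated on either side is small compared with the
-- edge j itself. If edge j is flat (bⱼ ≤ aⱼ) this makes Rⱼ₊₁ ≥ 0, and the fact that the corner of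
-- the quadrant lies strictly below the line of edge j pays for the rest; if the corner is no higher
-- than the next vertex, edge j + 1 takes over. Steep edges reduce to flat ones by reflecting
-- the slope in the antidiagonal.

open import Defs
open import Data.Nat as ℕ using (ℕ; zero; suc; _∸_)
import Data.Nat.Properties as ℕP
open import Data.Integer as ℤ using (ℤ; +_; -[1+_]; _+_; _-_; _*_; -_; _<_; _≤_)
import Data.Integer.Properties as ℤP
open import Data.Integer.GCD using (gcd-zeroʳ)
open import Data.Integer.Tactic.RingSolver using (solve-∀)
open import Data.Rational as ℚ using (ℚ; mkℚ; ↥_; ↧_; 0ℚ; 1ℚ; toℚᵘ)
import Data.Rational.Properties as ℚP
open import Data.Rational.Unnormalised as ℚᵘ using (mkℚᵘ; _≃_; *≡*; *<*)
import Data.Rational.Unnormalised.Properties as ℚᵘP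
open import Data.Empty using (⊥-elim)
open import Data.Product using (_×_; _,_; proj₁; proj₂; ∃)
open import Data.Sum using (inj₁; inj₂)
open import Function using (_∘_)
open import Relation.Binary.Definitions using (tri<; tri≈; tri>)
open import Relation.Binary.PropositionalEquality
open import Relation.Nullary using (yes; no)

infixl 6 _⊕_ _⊕⁺_ _⁺⊕_
infixl 7 _⊗_

_⊕_ : ∀ {i j} → + 0 ≤ i → + 0 ≤ j → + 0 ≤ i + j
_⊕_ = ℤP.+-mono-≤

_⁺⊕_ : ∀ {i j} → + 0 < i → + 0 ≤ j → + 0 < i + j
_⁺⊕_ = ℤP.+-mono-<-≤

_⊕⁺_ : ∀ {i j} → + 0 ≤ i → + 0 < j → + 0 < i + j
_⊕⁺_ = ℤP.+-mono-≤-<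

_⊗_ : ∀ {i j} → + 0 ≤ i → + 0 ≤ j → + 0 ≤ i * j
_⊗_ {i} {j} 0≤i 0≤j = subst (_≤ i * j) (ℤP.*-zeroˡ j) (ℤP.*-monoʳ-≤-nonNeg j {{ℤ.nonNegative 0≤j}} 0≤i)

*-pos : ∀ {i j} → + 0 < i → + 0 < j → + 0 < i * j
*-pos {i} {j} 0<i 0<j = subst (_< i * j) (ℤP.*-zeroˡ j) (ℤP.*-monoʳ-<-pos j {{ℤ.positive 0<j}} 0<i)

*-cancelˡ-nonNeg : ∀ {k i} → + 0 < k → + 0 ≤ k * i → + 0 ≤ i
*-cancelˡ-nonNeg {k} {i} 0<k 0≤k*i =
  ℤP.*-cancelˡ-≤-pos (+ 0) i k {{ℤ.positive 0<k}} (subst (_≤ k * i) (sym (ℤP.*-zeroʳ k)) 0≤k*i)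

*-cancelˡ-pos : ∀ {k i} → + 0 < k → + 0 < k * i → + 0 < i
*-cancelˡ-pos {k} {i} 0<k 0<k*i =
  ℤP.*-cancelˡ-<-nonNeg k {{ℤ.nonNegative (ℤP.<⇒≤ 0<k)}} (subst (_< k * i) (sym (ℤP.*-zeroʳ k)) 0<k*i)

i<j⇒0<j-i : ∀ {i j} → i < j → + 0 < j - i
i<j⇒0<j-i {i} {j} i<j = subst (_< j - i) (ℤP.+-inverseʳ i) (ℤP.+-monoˡ-< (- i) i<j)

0<i⇒0≤i-1 : ∀ {i} → + 0 < i → + 0 ≤ i - + 1
0<i⇒0≤i-1 0<i = ℤP.i≤j⇒0≤j-i (ℤP.i<j⇒suc[i]≤j 0<i)

0<i⇒0≤[i-1]*[i-2] : ∀ {i} → + 0 < i → + 0 ≤ (i - + 1) * (i - + 2)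
0<i⇒0≤[i-1]*[i-2] {+ 0} (ℤ.+<+ ())
0<i⇒0≤[i-1]*[i-2] {+ 1} _ = ℤP.≤-refl
0<i⇒0≤[i-1]*[i-2] {+ suc (suc n)} _ = _⊗_ {+ suc n} {+ n} (ℤ.+≤+ ℕ.z≤n) (ℤ.+≤+ ℕ.z≤n)

0<1 : + 0 < + 1
0<1 = ℤ.+<+ (ℕ.s≤s ℕ.z≤n)

0<2 : + 0 < + 2
0<2 = ℤ.+<+ (ℕ.s≤s ℕ.z≤n)

surplus-nonNeg : ∀ {p a b r} → + 0 < p → a ≤ p → b ≤ p → + 0 ≤ + 2 * p * r + a + b - + 2 → + 0 ≤ r
surplus-nonNeg {r = + n} _ _ _ _ = ℤ.+≤+ ℕ.z≤n
surplus-nonNeg {p} {a} {b} { -[1+ n ]} 0<p a≤p b≤p 0≤bound =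
  ⊥-elim (ℤP.<-irrefl (cancel p a b (+ n)) (0≤bound ⊕⁺ complement))
  where
  complement : + 0 < + 2 * p * + n + (p - a) + (p - b) + + 2
  complement = ℤP.<⇒≤ 0<2 ⊗ ℤP.<⇒≤ 0<p ⊗ ℤ.+≤+ ℕ.z≤n ⊕ ℤP.i≤j⇒0≤j-i a≤p ⊕ ℤP.i≤j⇒0≤j-i b≤p ⊕⁺ 0<2
  cancel : ∀ p a b m → + 0 ≡ (+ 2 * p * (- (+ 1 + m)) + a + b - + 2) + (+ 2 * p * m + (p - a) + (p - b) + + 2)
  cancel = solve-∀

-- When a = b the cross term b P + a q is a multiple of b ≥ 2, so it is at least 2.
flat-cross-margin : ∀ {a b P q} → + 2 ≤ b → b ≤ a → + 0 < b * P + a * q → + 0 < + 2 * (b * P + a * q - + 1) + (a - b)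
flat-cross-margin {a} {b} {P} {q} 2≤b b≤a 0<cross with b ℤ.≟ a
... | no b≢a = ℤP.<⇒≤ 0<2 ⊗ 0<i⇒0≤i-1 0<cross ⊕⁺ i<j⇒0<j-i (ℤP.≤∧≢⇒< b≤a b≢a)
... | yes refl = subst (+ 0 <_) (identity b P q) (ℤP.<⇒≤ 0<2 ⊗ (ℤP.<⇒≤ 0<b ⊗ 0<i⇒0≤i-1 0<P+q ⊕ ℤP.i≤j⇒0≤j-i 2≤b) ⊕⁺ 0<2)
  where
  0<b : + 0 < b
  0<b = ℤP.<-≤-trans 0<2 2≤b
  0<P+q : + 0 < P + q
  0<P+q = *-cancelˡ-pos 0<b (subst (+ 0 <_) (sym (ℤP.*-distribˡ-+ b P q)) 0<cross)
  identity : ∀ b P q → + 2 * (b * (P + q - + 1) + (b - + 2)) + + 2 ≡ + 2 * (b * P + b * q - + 1) + (b - b)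
  identity = solve-∀

-- Turns of lattice points

cross : ℤ² → ℤ² → ℤ
cross (a₁ , a₂) (b₁ , b₂) = a₁ * b₂ - b₁ * a₂

turn : ℤ² → ℤ² → ℤ² → ℤ
turn (p₁ , p₂) (q₁ , q₂) (r₁ , r₂) = (q₁ - p₁) * (r₂ - q₂) - (r₁ - q₁) * (q₂ - p₂)

frame : ℤ² → ℤ² → ℤ² → ℤ² → ℤ²
frame o f₁ f₂ (x , y) = (o +v (x • f₁)) +v (y • f₂)

cross-combination : ∀ f₁ f₂ p q r s →
  cross ((p • f₁) +v (q • f₂)) ((r • f₁) +v (s • f₂)) ≡ cross f₁ f₂ * (p * s - q * r)
cross-combination (f₁₁ , f₁₂) (f₂₁ , f₂₂) = identity f₁₁ f₁₂ f₂₁ f₂₂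
  where
  identity : ∀ f₁₁ f₁₂ f₂₁ f₂₂ p q r s →
    (p * f₁₁ + q * f₂₁) * (r * f₁₂ + s * f₂₂) - (r * f₁₁ + s * f₂₁) * (p * f₁₂ + q * f₂₂)
    ≡ (f₁₁ * f₂₂ - f₂₁ * f₁₂) * (p * s - q * r)
  identity = solve-∀

basis-cross-unit : ∀ {f₁ f₂} → IsBasis f₁ f₂ → ∃ λ g → cross f₁ f₂ * g ≡ + 1
basis-cross-unit {f₁} {f₂} (spans , _) with spans (+ 1 , + 0) | spans (+ 0 , + 1)
... | p , q , e₁ | r , s , e₂ =
  p * s - q * r , trans (sym (cross-combination f₁ f₂ p q r s)) (cong₂ cross (sym e₁) (sym e₂))

turn-frame : ∀ o f₁ f₂ p q r →
  turn (frame o f₁ f₂ p) (frame o f₁ f₂ q) (frame o f₁ f₂ r) ≡ cross f₁ f₂ * turn p q r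
turn-frame (o₁ , o₂) (f₁₁ , f₁₂) (f₂₁ , f₂₂) (x₀ , y₀) (x₁ , y₁) (x₂ , y₂) =
  identity o₁ o₂ f₁₁ f₁₂ f₂₁ f₂₂ x₀ y₀ x₁ y₁ x₂ y₂
  where
  identity : ∀ o₁ o₂ f₁₁ f₁₂ f₂₁ f₂₂ x₀ y₀ x₁ y₁ x₂ y₂ →
    (((o₁ + x₁ * f₁₁) + y₁ * f₂₁) - ((o₁ + x₀ * f₁₁) + y₀ * f₂₁)) * (((o₂ + x₂ * f₁₂) + y₂ * f₂₂) - ((o₂ + x₁ * f₁₂) + y₁ * f₂₂))
    - (((o₁ + x₂ * f₁₁) + y₂ * f₂₁) - ((o₁ + x₁ * f₁₁) + y₁ * f₂₁)) * (((o₂ + x₁ * f₁₂) + y₁ * f₂₂) - ((o₂ + x₀ * f₁₂) + y₀ * f₂₂))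
    ≡ (f₁₁ * f₂₂ - f₂₁ * f₁₂) * ((x₁ - x₀) * (y₂ - y₁) - (x₂ - x₁) * (y₁ - y₀))
  identity = solve-∀

turn-· : ∀ A p q r → turn (A · p) (A · q) (A · r) ≡ det A * turn p q r
turn-· (mat a b c d) (p₁ , p₂) (q₁ , q₂) (r₁ , r₂) = identity a b c d p₁ p₂ q₁ q₂ r₁ r₂
  where
  identity : ∀ a b c d p₁ p₂ q₁ q₂ r₁ r₂ →
    ((a * q₁ + b * q₂) - (a * p₁ + b * p₂)) * ((c * r₁ + d * r₂) - (c * q₁ + d * q₂))
    - ((a * r₁ + b * r₂) - (a * q₁ + b * q₂)) * ((c * q₁ + d * q₂) - (c * p₁ + d * p₂))
    ≡ (a * d - b * c) * ((q₁ - p₁) * (r₂ - q₂) - (r₁ - q₁) * (q₂ - p₂))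
  identity = solve-∀

adjugate : Mat2 → ℤ² → ℤ²
adjugate (mat a b c d) (w₁ , w₂) = (d * w₁ - b * w₂ , a * w₂ - c * w₁)

·-adjugate : ∀ A g w → A · (g • adjugate A w) ≡ (det A * g) • w
·-adjugate (mat a b c d) g (w₁ , w₂) = cong₂ _,_ (identity₁ a b c d g w₁ w₂) (identity₂ a b c d g w₁ w₂)
  where
  identity₁ : ∀ a b c d g w₁ w₂ → a * (g * (d * w₁ - b * w₂)) + b * (g * (a * w₂ - c * w₁)) ≡ ((a * d - b * c) * g) * w₁
  identity₁ = solve-∀
  identity₂ : ∀ a b c d g w₁ w₂ → c * (g * (d * w₁ - b * w₂)) + d * (g * (a * w₂ - c * w₁)) ≡ ((a * d - b * c) * g) * w₂
  identity₂ = solve-∀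

•-identityˡ : ∀ w → (+ 1) • w ≡ w
•-identityˡ (w₁ , w₂) = cong₂ _,_ (ℤP.*-identityˡ w₁) (ℤP.*-identityˡ w₂)

proper⇒det-non-unit : ∀ {A} → ProperSublattice A → ∀ g → det A * g ≢ + 1
proper⇒det-non-unit {A} (_ , w , w∉A) g det*g≡1 =
  w∉A (g • adjugate A w , sym (trans (·-adjugate A g w) (trans (cong (_• w) det*g≡1) (•-identityˡ w))))

sublattice-turn≥2 : ∀ {o f₁ f₂ A} → IsBasis f₁ f₂ → ProperSublattice A → ∀ p q r →
  frame o f₁ f₂ p ∈Lat A → frame o f₁ f₂ q ∈Lat A → frame o f₁ f₂ r ∈Lat A →
  + 0 < turn p q r → + 2 ≤ turn p q r
sublattice-turn≥2 {o} {f₁} {f₂} {A} basis proper p q r (zp , ep) (zq , eq) (zr , er) 0<turn =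
  ℤP.i<j⇒suc[i]≤j (ℤP.≤∧≢⇒< (ℤP.i<j⇒suc[i]≤j 0<turn) (proper⇒det-non-unit {A} proper (turn zp zq zr * g) ∘ det-unit))
  where
  g : ℤ
  g = proj₁ (basis-cross-unit basis)
  det-unit : + 1 ≡ turn p q r → det A * (turn zp zq zr * g) ≡ + 1
  det-unit 1≡turn = begin
    det A * (turn zp zq zr * g)                                      ≡⟨ ℤP.*-assoc (det A) _ g ⟨
    det A * turn zp zq zr * g                                        ≡⟨ cong (_* g) (turn-· A zp zq zr) ⟨
    turn (A · zp) (A · zq) (A · zr) * g                              ≡⟨ cong (_* g) (cong₂ (λ s t → turn s t (A · zr)) ep eq) ⟨
    turn (frame o f₁ f₂ p) (frame o f₁ f₂ q) (A · zr) * g            ≡⟨ cong (λ t → turn (frame o f₁ f₂ p) (frame o f₁ f₂ q) t * g) er ⟨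
    turn (frame o f₁ f₂ p) (frame o f₁ f₂ q) (frame o f₁ f₂ r) * g   ≡⟨ cong (_* g) (turn-frame o f₁ f₂ p q r) ⟩
    cross f₁ f₂ * turn p q r * g                                     ≡⟨ cong (λ t → cross f₁ f₂ * t * g) 1≡turn ⟨
    cross f₁ f₂ * + 1 * g                                            ≡⟨ cong (_* g) (ℤP.*-identityʳ (cross f₁ f₂)) ⟩
    cross f₁ f₂ * g                                                  ≡⟨ proj₂ (basis-cross-unit basis) ⟩
    + 1                                                              ∎
    where open ≡-Reasoning

-- Slopes whose consecutive edges turn by at least two

∸-suc : ∀ {k N} → k ℕ.< N → N ∸ k ≡ suc (N ∸ suc k)
∸-suc = ℕP.+-∸-assoc 1

∸-suc-< : ∀ {k N} → k ℕ.< N → N ∸ suc k ℕ.< N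
∸-suc-< {k} {N} k<N = subst (ℕ._≤ N) (∸-suc k<N) (ℕP.m∸n≤m N k)

N∸suc[N∸suc[k]]≡k : ∀ {k N} → k ℕ.< N → N ∸ suc (N ∸ suc k) ≡ k
N∸suc[N∸suc[k]]≡k k<N = ℕP.suc-injective (trans (sym (∸-suc (∸-suc-< k<N))) (ℕP.m∸[m∸n]≡n k<N))

record SublatticeSlope (N : ℕ) (x y : ℕ → ℤ) : Set where
  field
    x-increasing : ∀ k → k ℕ.< N → x k < x (suc k)
    y-decreasing : ∀ k → k ℕ.< N → y (suc k) < y k
    turn≥2 : ∀ k → suc k ℕ.< N →
      + 2 ≤ turn (x k , y k) (x (suc k) , y (suc k)) (x (suc (suc k)) , y (suc (suc k)))

Δ⁺ Δ⁻ : (ℕ → ℤ) → ℕ → ℤ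
Δ⁺ x k = x (suc k) - x k
Δ⁻ y k = y k - y (suc k)

-- headSurplus y k = Σ_{i<k} (Δ⁻ y i - 2) and tailSurplus N x k = Σ_{k≤i<N} (Δ⁺ x i - 2).

headSurplus : (ℕ → ℤ) → ℕ → ℤ
headSurplus y k = (y 0 - y k) - + 2 * + k

tailSurplus : ℕ → (ℕ → ℤ) → ℕ → ℤ
tailSurplus N x k = (x N - x k) - + 2 * (+ N - + k)

excess : ℕ → (ℕ → ℤ) → (ℕ → ℤ) → ℤ → ℤ → ℤ
excess N x y u w = (x N - u) + (y 0 - w) - + 2 * + N

module _ {N : ℕ} {x y : ℕ → ℤ} (S : SublatticeSlope N x y) where
  open SublatticeSlope S

  Δ⁺-pos : ∀ {k} → k ℕ.< N → + 0 < Δ⁺ x k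
  Δ⁺-pos k<N = i<j⇒0<j-i (x-increasing _ k<N)

  Δ⁻-pos : ∀ {k} → k ℕ.< N → + 0 < Δ⁻ y k
  Δ⁻-pos k<N = i<j⇒0<j-i (y-decreasing _ k<N)

  turn-Δ : ∀ {k} → suc k ℕ.< N → + 2 ≤ Δ⁺ x (suc k) * Δ⁻ y k - Δ⁺ x k * Δ⁻ y (suc k)
  turn-Δ {k} sk<N = subst (+ 2 ≤_) (identity (x k) (x (suc k)) (x (suc (suc k))) (y k) (y (suc k)) (y (suc (suc k)))) (turn≥2 k sk<N)
    where
    identity : ∀ x₀ x₁ x₂ y₀ y₁ y₂ → (x₁ - x₀) * (y₂ - y₁) - (x₂ - x₁) * (y₁ - y₀) ≡ (x₂ - x₁) * (y₀ - y₁) - (x₁ - x₀) * (y₁ - y₂)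
    identity = solve-∀

  headSurplus-bound : ∀ k → k ℕ.< N → + 0 ≤ + 2 * Δ⁻ y k * headSurplus y k + Δ⁺ x k + Δ⁻ y k - + 2
  headSurplus-bound zero 0<N = subst (+ 0 ≤_) (identity (y 0) (Δ⁺ x 0) (Δ⁻ y 0)) (0<i⇒0≤i-1 (Δ⁺-pos 0<N) ⊕ 0<i⇒0≤i-1 (Δ⁻-pos 0<N))
    where
    identity : ∀ y₀ a b → (a - + 1) + (b - + 1) ≡ + 2 * b * ((y₀ - y₀) - + 2 * + 0) + a + b - + 2
    identity = solve-∀
  headSurplus-bound (suc k) sk<N = *-cancelˡ-nonNeg (Δ⁻-pos k<N) (subst (+ 0 ≤_) (identity (y 0) (y k) (y (suc k)) a c d (+ k)) certificate)
    where
    k<N = ℕP.<⇒≤ sk<N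
    a = Δ⁺ x k ; b = Δ⁻ y k ; c = Δ⁺ x (suc k) ; d = Δ⁻ y (suc k)
    b-1≥0 = 0<i⇒0≤i-1 (Δ⁻-pos k<N)
    certificate : + 0 ≤ d * (+ 2 * b * headSurplus y k + a + b - + 2) + + 2 * ((b - + 1) * (b - + 1) * (d - + 1) + (b - + 1) * (b - + 2)) + (c * b - a * d - + 2)
    certificate = ℤP.<⇒≤ (Δ⁻-pos sk<N) ⊗ headSurplus-bound k k<N
                ⊕ ℤP.<⇒≤ 0<2 ⊗ (b-1≥0 ⊗ b-1≥0 ⊗ 0<i⇒0≤i-1 (Δ⁻-pos sk<N) ⊕ 0<i⇒0≤[i-1]*[i-2] (Δ⁻-pos k<N))
                ⊕ ℤP.i≤j⇒0≤j-i (turn-Δ sk<N)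
    identity : ∀ y₀ yₖ yₖ₁ a c d k →
      d * (+ 2 * (yₖ - yₖ₁) * ((y₀ - yₖ) - + 2 * k) + a + (yₖ - yₖ₁) - + 2)
        + + 2 * (((yₖ - yₖ₁) - + 1) * ((yₖ - yₖ₁) - + 1) * (d - + 1) + ((yₖ - yₖ₁) - + 1) * ((yₖ - yₖ₁) - + 2))
        + (c * (yₖ - yₖ₁) - a * d - + 2)
      ≡ (yₖ - yₖ₁) * (+ 2 * d * ((y₀ - yₖ₁) - + 2 * (+ 1 + k)) + c + d - + 2)
    identity = solve-∀

mirror : ∀ {N x y} → SublatticeSlope N x y → SublatticeSlope N (y ∘ (N ∸_)) (x ∘ (N ∸_))
mirror {N} {x} {y} S = record
  { x-increasing = λ k k<N → subst (λ i → y i < y (N ∸ suc k)) (sym (∸-suc k<N)) (y-decreasing (N ∸ suc k) (∸-suc-< k<N))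
  ; y-decreasing = λ k k<N → subst (λ i → x (N ∸ suc k) < x i) (sym (∸-suc k<N)) (x-increasing (N ∸ suc k) (∸-suc-< k<N))
  ; turn≥2 = turn≥2′
  }
  where
  open SublatticeSlope S
  turn≥2′ : ∀ k → suc k ℕ.< N → + 2 ≤ turn (y (N ∸ k) , x (N ∸ k)) (y (N ∸ suc k) , x (N ∸ suc k)) (y (N ∸ suc (suc k)) , x (N ∸ suc (suc k)))
  turn≥2′ k sk<N rewrite ∸-suc (ℕP.<⇒≤ sk<N) | ∸-suc sk<N =
    subst (+ 2 ≤_) (turn-reversed (x m) (x (suc m)) (x (suc (suc m))) (y m) (y (suc m)) (y (suc (suc m)))) (turn≥2 m (subst (ℕ._< N) (∸-suc sk<N) (∸-suc-< (ℕP.<⇒≤ sk<N))))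
    where
    m = N ∸ suc (suc k)
    turn-reversed : ∀ x₀ x₁ x₂ y₀ y₁ y₂ → (x₁ - x₀) * (y₂ - y₁) - (x₂ - x₁) * (y₁ - y₀) ≡ (y₁ - y₂) * (x₀ - x₁) - (y₀ - y₁) * (x₁ - x₂)
    turn-reversed = solve-∀

module _ {N : ℕ} {x y : ℕ → ℤ} (S : SublatticeSlope N x y) where

  -- The tail of a slope is the head of its mirror image.
  tailSurplus-bound : ∀ k → k ℕ.< N → + 0 ≤ + 2 * Δ⁺ x k * tailSurplus N x (suc k) + Δ⁻ y k + Δ⁺ x k - + 2
  tailSurplus-bound k k<N =
    reindex (ℕP.m∸[m∸n]≡n k<N) (N∸suc[N∸suc[k]]≡k k<N) (sym (trans (ℤP.m-n≡m⊖n N (suc k)) (ℤP.⊖-≥ k<N)))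
      (headSurplus-bound (mirror S) (N ∸ suc k) (∸-suc-< k<N))
    where
    reindex : ∀ {i j n} → i ≡ suc k → j ≡ k → + n ≡ + N - + suc k →
      + 0 ≤ + 2 * (x i - x j) * ((x N - x i) - + 2 * + n) + (y j - y i) + (x i - x j) - + 2 →
      + 0 ≤ + 2 * Δ⁺ x k * tailSurplus N x (suc k) + Δ⁻ y k + Δ⁺ x k - + 2
    reindex refl refl eq = subst (λ n → + 0 ≤ + 2 * Δ⁺ x k * ((x N - x (suc k)) - + 2 * n) + Δ⁻ y k + Δ⁺ x k - + 2) eq

  tailSurplus-nonNeg : ∀ {k} → k ℕ.< N → Δ⁻ y k ≤ Δ⁺ x k → + 0 ≤ tailSurplus N x (suc k)
  tailSurplus-nonNeg {k} k<N b≤a = surplus-nonNeg (Δ⁺-pos S k<N) b≤a ℤP.≤-refl (tailSurplus-bound k k<N)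

  excess-pos-inside-flat-edge : ∀ {j u w} → j ℕ.< N → u < x (suc j) → y (suc j) < w → w < y j →
    + 0 < Δ⁻ y j * (x (suc j) - u) + Δ⁺ x j * (y (suc j) - w) → Δ⁻ y j ≤ Δ⁺ x j → + 0 < excess N x y u w
  excess-pos-inside-flat-edge {j} {u} {w} j<N u<x y<w w<y 0<cross b≤a =
    subst (+ 0 <_) (sym (split (x N) (y 0) (x (suc j)) (y j) u w (+ N) (+ j)))
      (*-cancelˡ-pos (*-pos 0<2 (Δ⁻-pos S j<N)) (subst (+ 0 <_) (identity a (y j) (y (suc j)) w (headSurplus y j) P) certificate)
       ⁺⊕ tailSurplus-nonNeg j<N b≤a)
    where
    a = Δ⁺ x j ; b = Δ⁻ y j ; P = x (suc j) - u
    2≤b : + 2 ≤ b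
    2≤b = ℤP.0≤i-j⇒j≤i (subst (+ 0 ≤_) (two (y j) (y (suc j)) w) (0<i⇒0≤i-1 (i<j⇒0<j-i w<y) ⊕ 0<i⇒0≤i-1 (i<j⇒0<j-i y<w)))
      where
      two : ∀ yⱼ yⱼ₁ w → (yⱼ - w - + 1) + (w - yⱼ₁ - + 1) ≡ (yⱼ - yⱼ₁) - + 2
      two = solve-∀
    certificate : + 0 < (+ 2 * (b * P + a * (y (suc j) - w) - + 1) + (a - b)) + (+ 2 * b * headSurplus y j + a + b - + 2)
                      + + 2 * ((a - b) * ((w - y (suc j)) - + 1)) + + 2 * ((b - + 1) * (b - + 2))
    certificate = flat-cross-margin 2≤b b≤a 0<cross ⁺⊕ headSurplus-bound S j j<N
                ⁺⊕ ℤP.<⇒≤ 0<2 ⊗ (ℤP.i≤j⇒0≤j-i b≤a ⊗ 0<i⇒0≤i-1 (i<j⇒0<j-i y<w))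
                ⁺⊕ ℤP.<⇒≤ 0<2 ⊗ 0<i⇒0≤[i-1]*[i-2] (Δ⁻-pos S j<N)
    identity : ∀ a yⱼ yⱼ₁ w L P →
      (+ 2 * ((yⱼ - yⱼ₁) * P + a * (yⱼ₁ - w) - + 1) + (a - (yⱼ - yⱼ₁))) + (+ 2 * (yⱼ - yⱼ₁) * L + a + (yⱼ - yⱼ₁) - + 2)
        + + 2 * ((a - (yⱼ - yⱼ₁)) * ((w - yⱼ₁) - + 1)) + + 2 * (((yⱼ - yⱼ₁) - + 1) * ((yⱼ - yⱼ₁) - + 2))
      ≡ (+ 2 * (yⱼ - yⱼ₁)) * (L + (P + (yⱼ - w) - + 2))
    identity = solve-∀
    split : ∀ x_N y₀ xⱼ₁ yⱼ u w N j →
      (x_N - u) + (y₀ - w) - + 2 * N ≡ ((y₀ - yⱼ) - + 2 * j + ((xⱼ₁ - u) + (yⱼ - w) - + 2)) + ((x_N - xⱼ₁) - + 2 * (N - (+ 1 + j)))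
    split = solve-∀

  excess-pos-below-flat-vertex : ∀ {j u} → j ℕ.< N → u < x (suc j) → y N < y (suc j) → Δ⁻ y j ≤ Δ⁺ x j →
    + 0 < excess N x y u (y (suc j))
  excess-pos-below-flat-vertex {j} {u} j<N u<x yN<y b≤a =
    subst (+ 0 <_) (sym (split (x N) (y 0) (x (suc j)) (x (suc (suc j))) (y (suc j)) u (+ N) (+ j)))
      (*-cancelˡ-pos (*-pos 0<2 (Δ⁻-pos S sj<N)) (subst (+ 0 <_) (identity c d P (headSurplus y (suc j)) (tailSurplus N x (suc (suc j)))) certificate))
    where
    sj<N : suc j ℕ.< N
    sj<N = ℕP.≤∧≢⇒< j<N (λ sj≡N → ℤP.<-irrefl (cong y (sym sj≡N)) yN<y)
    a = Δ⁺ x j ; b = Δ⁻ y j ; c = Δ⁺ x (suc j) ; d = Δ⁻ y (suc j) ; P = x (suc j) - u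
    0<d = Δ⁻-pos S sj<N
    0<c-d : + 0 < c - d
    0<c-d = *-cancelˡ-pos (Δ⁻-pos S j<N) (subst (+ 0 <_) (identity′ a b c d) (ℤP.i≤j⇒0≤j-i (turn-Δ S sj<N) ⊕⁺ 0<2 ⁺⊕ ℤP.i≤j⇒0≤j-i b≤a ⊗ ℤP.<⇒≤ 0<d))
      where
      identity′ : ∀ a b c d → (c * b - a * d - + 2) + + 2 + (a - b) * d ≡ b * (c - d)
      identity′ = solve-∀
    2d≥0 : + 0 ≤ + 2 * d
    2d≥0 = ℤP.<⇒≤ 0<2 ⊗ ℤP.<⇒≤ 0<d
    certificate : + 0 < + 2 * d * (P - + 1) + (+ 2 * d * headSurplus y (suc j) + c + d - + 2) + (c - d - + 1) * (d + (d - + 1))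
                      + + 2 * d * (d - + 1) + + 2 * d * tailSurplus N x (suc (suc j)) + + 1
    certificate = 2d≥0 ⊗ 0<i⇒0≤i-1 (i<j⇒0<j-i u<x) ⊕ headSurplus-bound S (suc j) sj<N
                ⊕ 0<i⇒0≤i-1 0<c-d ⊗ (ℤP.<⇒≤ 0<d ⊕ 0<i⇒0≤i-1 0<d)
                ⊕ 2d≥0 ⊗ 0<i⇒0≤i-1 0<d ⊕ 2d≥0 ⊗ tailSurplus-nonNeg sj<N (ℤP.0≤i-j⇒j≤i (ℤP.<⇒≤ 0<c-d)) ⊕⁺ 0<1
    identity : ∀ c d P L R → + 2 * d * (P - + 1) + (+ 2 * d * L + c + d - + 2) + (c - d - + 1) * (d + (d - + 1))
                      + + 2 * d * (d - + 1) + + 2 * d * R + + 1 ≡ + 2 * d * (P + L + R + c - + 2)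
    identity = solve-∀
    split : ∀ x_N y₀ xⱼ₁ xⱼ₂ yⱼ₁ u N j →
      (x_N - u) + (y₀ - yⱼ₁) - + 2 * N ≡ (xⱼ₁ - u) + ((y₀ - yⱼ₁) - + 2 * (+ 1 + j)) + ((x_N - xⱼ₂) - + 2 * (N - (+ 1 + (+ 1 + j)))) + (xⱼ₂ - xⱼ₁) - + 2
    split = solve-∀

  excess-pos-flat : ∀ {j u w} → j ℕ.< N → u < x (suc j) → w < y j → y N < w →
    + 0 < Δ⁻ y j * (x (suc j) - u) + Δ⁺ x j * (y (suc j) - w) → Δ⁻ y j ≤ Δ⁺ x j → + 0 < excess N x y u w
  excess-pos-flat {j} {u} {w} j<N u<x w<y yN<w 0<cross b≤a with ℤP.<-cmp w (y (suc j))
  ... | tri< w<y′ _ _ = subst (+ 0 <_) (shift (x N) (y 0) (y (suc j)) u w (+ N))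
                          (excess-pos-below-flat-vertex j<N u<x (ℤP.<-trans yN<w w<y′) b≤a ⁺⊕ ℤP.i≤j⇒0≤j-i (ℤP.<⇒≤ w<y′))
    where
    shift : ∀ x_N y₀ w′ u w N → (x_N - u) + (y₀ - w′) - + 2 * N + (w′ - w) ≡ (x_N - u) + (y₀ - w) - + 2 * N
    shift = solve-∀
  ... | tri≈ _ refl _ = excess-pos-below-flat-vertex j<N u<x yN<w b≤a
  ... | tri> _ _ y<w = excess-pos-inside-flat-edge j<N u<x y<w w<y 0<cross b≤a

module _ {N : ℕ} {x y : ℕ → ℤ} (S : SublatticeSlope N x y) where

  excess-pos-steep : ∀ {j u w} → j ℕ.< N → u < x (suc j) → w < y j → x 0 < u →
    + 0 < Δ⁻ y j * (x (suc j) - u) + Δ⁺ x j * (y (suc j) - w) → Δ⁺ x j ≤ Δ⁻ y j → + 0 < excess N x y u w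
  excess-pos-steep {j} {u} {w} j<N u<x w<y x₀<u 0<cross a≤b =
    reflect (ℕP.m∸[m∸n]≡n j<N) (N∸suc[N∸suc[k]]≡k j<N) (ℕP.n∸n≡0 N)
      (excess-pos-flat (mirror S) (∸-suc-< j<N))
    where
    reflect : ∀ {i i′ z} → i ≡ suc j → i′ ≡ j → z ≡ 0 →
      (w < y i′ → u < x i → x z < u → + 0 < (x i - x i′) * (y i′ - w) + (y i′ - y i) * (x i′ - u) → x i - x i′ ≤ y i′ - y i →
       + 0 < (y z - w) + (x N - u) - + 2 * + N) →
      + 0 < excess N x y u w
    reflect refl refl refl flat = subst (+ 0 <_) (swap (x N) (y 0) u w (+ N))
      (flat w<y u<x x₀<u (subst (+ 0 <_) (cross-swap (x j) (x (suc j)) (y j) (y (suc j)) u w) 0<cross) a≤b)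
      where
      swap : ∀ x_N y₀ u w N → (y₀ - w) + (x_N - u) - + 2 * N ≡ (x_N - u) + (y₀ - w) - + 2 * N
      swap = solve-∀
      cross-swap : ∀ xⱼ xⱼ₁ yⱼ yⱼ₁ u w →
        (yⱼ - yⱼ₁) * (xⱼ₁ - u) + (xⱼ₁ - xⱼ) * (yⱼ₁ - w) ≡ (xⱼ₁ - xⱼ) * (yⱼ - w) + (yⱼ - yⱼ₁) * (xⱼ - u)
      cross-swap = solve-∀

  -- The cross-term hypothesis says that (u, w) lies strictly below the line through edge j.
  excess-pos : ∀ {j u w} → j ℕ.< N → u < x (suc j) → w < y j → x 0 < u → y N < w →
    + 0 < Δ⁻ y j * (x (suc j) - u) + Δ⁺ x j * (y (suc j) - w) → + 0 < excess N x y u w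
  excess-pos {j} j<N u<x w<y x₀<u yN<w 0<cross with ℤP.≤-total (Δ⁻ y j) (Δ⁺ x j)
  ... | inj₁ b≤a = excess-pos-flat S j<N u<x w<y yN<w 0<cross b≤a
  ... | inj₂ a≤b = excess-pos-steep j<N u<x w<y x₀<u 0<cross a≤b

-- The splitting edge and π̂(E)

ι : ℤ → ℚ
ι z = z ℚ./ 1

↥ι : ∀ z → ↥ ι z ≡ z
↥ι z = trans (sym (ℤP.*-identityʳ _)) (trans (cong (↥ ι z *_) (sym (gcd-zeroʳ z))) (ℚP.↥-/ z 1))

↧ι : ∀ z → ↧ ι z ≡ + 1
↧ι z = trans (sym (ℤP.*-identityʳ _)) (trans (cong (↧ ι z *_) (sym (gcd-zeroʳ z))) (ℚP.↧-/ z 1))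

toℚᵘ-integral : ∀ p → ↧ p ≡ + 1 → toℚᵘ p ≃ mkℚᵘ (↥ p) 0
toℚᵘ-integral (mkℚ n d _) ↧p≡1 = *≡* (cong (n *_) (sym ↧p≡1))

toℚᵘ-ι : ∀ z → toℚᵘ (ι z) ≃ mkℚᵘ z 0
toℚᵘ-ι z = subst (λ m → toℚᵘ (ι z) ≃ mkℚᵘ m 0) (↥ι z) (toℚᵘ-integral (ι z) (↧ι z))

0<x+t*a⇒0<x*↧t+↥t*a : ∀ x a t → 0ℚ ℚ.< ι x ℚ.+ t ℚ.* ι a → + 0 < x * ↧ t + ↥ t * a
0<x+t*a⇒0<x*↧t+↥t*a x a t@(mkℚ n d _) 0<x+t*a with ℚᵘP.<-respʳ-≃ unnormalised (ℚP.toℚᵘ-mono-< 0<x+t*a)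
  where
  unnormalised : toℚᵘ (ι x ℚ.+ t ℚ.* ι a) ≃ mkℚᵘ x 0 ℚᵘ.+ mkℚᵘ n d ℚᵘ.* mkℚᵘ a 0
  unnormalised = ℚᵘP.≃-trans (ℚP.toℚᵘ-homo-+ (ι x) (t ℚ.* ι a))
                   (ℚᵘP.+-cong (toℚᵘ-ι x) (ℚᵘP.≃-trans (ℚP.toℚᵘ-homo-* t (ι a)) (ℚᵘP.*-cong (ℚᵘP.≃-refl {toℚᵘ t}) (toℚᵘ-ι a))))
... | *<* 0<numerator = subst₂ _<_ (ℤP.*-zeroˡ (+ (suc d ℕ.* 1))) numerator 0<numerator
  where
  numerator : (x * + (suc d ℕ.* 1) + n * a * + 1) * + 1 ≡ x * + suc d + n * a
  numerator = trans (ℤP.*-identityʳ _) (cong₂ _+_ (cong (λ m → x * + m) (ℕP.*-identityʳ (suc d))) (ℤP.*-identityʳ _))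

0≤t≤1⇒0≤↥t≤↧t : ∀ t → 0ℚ ℚ.≤ t → t ℚ.≤ 1ℚ → + 0 ≤ ↥ t × ↥ t ≤ ↧ t
0≤t≤1⇒0≤↥t≤↧t (mkℚ n d _) (ℚ.*≤* 0≤n) (ℚ.*≤* n≤d) =
  subst (+ 0 ≤_) (ℤP.*-identityʳ n) 0≤n , subst₂ _≤_ (ℤP.*-identityʳ n) (ℤP.*-identityˡ (+ suc d)) n≤d

edge-through-quadrant : ∀ {x₀ y₀ x₁ y₁ n D} → x₀ < x₁ → y₁ < y₀ → + 0 < D → + 0 ≤ n → n ≤ D →
  + 0 < x₀ * D + n * (x₁ - x₀) → + 0 < y₀ * D + n * (y₁ - y₀) →
  + 0 < x₁ × + 0 < y₀ × + 0 < (y₀ - y₁) * (x₁ - + 0) + (x₁ - x₀) * (y₁ - + 0)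
edge-through-quadrant {x₀} {y₀} {x₁} {y₁} {n} {D} x₀<x₁ y₁<y₀ 0<D 0≤n n≤D 0<X 0<Y =
    *-cancelˡ-pos 0<D (subst (+ 0 <_) (identity₁ x₀ x₁ n D) (0<X ⁺⊕ ℤP.i≤j⇒0≤j-i n≤D ⊗ ℤP.<⇒≤ (i<j⇒0<j-i x₀<x₁)))
  , *-cancelˡ-pos 0<D (subst (+ 0 <_) (identity₂ y₀ y₁ n D) (0<Y ⁺⊕ 0≤n ⊗ ℤP.<⇒≤ (i<j⇒0<j-i y₁<y₀)))
  , *-cancelˡ-pos 0<D (subst (+ 0 <_) (identity₃ x₀ y₀ x₁ y₁ n D) (*-pos (i<j⇒0<j-i y₁<y₀) 0<X ⁺⊕ ℤP.<⇒≤ (*-pos (i<j⇒0<j-i x₀<x₁) 0<Y)))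
  where
  identity₁ : ∀ x₀ x₁ n D → x₀ * D + n * (x₁ - x₀) + (D - n) * (x₁ - x₀) ≡ D * x₁
  identity₁ = solve-∀
  identity₂ : ∀ y₀ y₁ n D → y₀ * D + n * (y₁ - y₀) + n * (y₀ - y₁) ≡ D * y₀
  identity₂ = solve-∀
  identity₃ : ∀ x₀ y₀ x₁ y₁ n D → (y₀ - y₁) * (x₀ * D + n * (x₁ - x₀)) + (x₁ - x₀) * (y₀ * D + n * (y₁ - y₀))
    ≡ D * ((y₀ - y₁) * (x₁ - + 0) + (x₁ - x₀) * (y₁ - + 0))
  identity₃ = solve-∀

splitting-edge : ∀ {N c₁ c₂} → IsIntegerSlope N c₁ c₂ → Splits N c₁ c₂ →
  ∃ λ j → j ℕ.< N × + 0 < c₁ (suc j) × + 0 < c₂ j × + 0 < Δ⁻ c₂ j * (c₁ (suc j) - + 0) + Δ⁺ c₁ j * (c₂ (suc j) - + 0)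
splitting-edge {c₁ = c₁} {c₂} (steps , _) (_ , _ , _ , _ , j , j<N , t , 0≤t , t≤1 , 0<x , 0<y) =
  j , j<N , edge-through-quadrant (proj₁ (steps j j<N)) (proj₂ (steps j j<N)) 0<↧t 0≤↥t ↥t≤↧t
              (0<x+t*a⇒0<x*↧t+↥t*a (c₁ j) (c₁ (suc j) - c₁ j) t 0<x) (0<x+t*a⇒0<x*↧t+↥t*a (c₂ j) (c₂ (suc j) - c₂ j) t 0<y)
  where
  0<↧t : + 0 < ↧ t
  0<↧t = ℤ.+<+ (ℕ.s≤s ℕ.z≤n)
  0≤↥t = proj₁ (0≤t≤1⇒0≤↥t≤↧t t 0≤t t≤1)
  ↥t≤↧t = proj₂ (0≤t≤1⇒0≤↥t≤↧t t 0≤t t≤1)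

π̂E-telescopes : ∀ N c₁ c₂ → π̂E N c₁ c₂ ≡ (c₁ N ⁺ - c₁ 0 ⁺) + (c₂ 0 ⁺ - c₂ N ⁺) - + 2 * + N
π̂E-telescopes zero c₁ c₂ = identity (c₁ 0 ⁺) (c₂ 0 ⁺)
  where
  identity : ∀ p q → + 0 ≡ (p - p) + (q - q) - + 2 * + 0
  identity = solve-∀
π̂E-telescopes (suc N) c₁ c₂ = trans (cong (_+ π̂ c₁ c₂ (suc N)) (π̂E-telescopes N c₁ c₂))
  (identity (c₁ 0 ⁺) (c₁ N ⁺) (c₁ (suc N) ⁺) (c₂ 0 ⁺) (c₂ N ⁺) (c₂ (suc N) ⁺) (+ N))
  where
  identity : ∀ p₀ p p′ q₀ q q′ n → (p - p₀) + (q₀ - q) - + 2 * n + ((p′ - p) + (q - q′) - + 2) ≡ (p′ - p₀) + (q₀ - q′) - + 2 * (+ 1 + n)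
  identity = solve-∀

π̂E≡excess : ∀ {N c₁ c₂} → c₁ 0 < + 0 → + 0 < c₂ 0 → + 0 < c₁ N → c₂ N < + 0 → π̂E N c₁ c₂ ≡ excess N c₁ c₂ (+ 0) (+ 0)
π̂E≡excess {N} {c₁} {c₂} x₀<0 0<y₀ 0<x_N y_N<0 = trans (π̂E-telescopes N c₁ c₂)
  (cong₂ (λ p q → p + q - + 2 * + N)
    (cong₂ _-_ (ℤP.i≥j⇒i⊔j≡i (ℤP.<⇒≤ 0<x_N)) (ℤP.i≤j⇒i⊔j≡j (ℤP.<⇒≤ x₀<0)))
    (cong₂ _-_ (ℤP.i≥j⇒i⊔j≡i (ℤP.<⇒≤ 0<y₀)) (ℤP.i≤j⇒i⊔j≡j (ℤP.<⇒≤ y_N<0))))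

integer-slope⇒sublattice-slope : ∀ {o f₁ f₂ A N c₁ c₂} → IsBasis f₁ f₂ → ProperSublattice A →
  (∀ k → k ℕ.≤ N → frame o f₁ f₂ (c₁ k , c₂ k) ∈Lat A) → IsIntegerSlope N c₁ c₂ → SublatticeSlope N c₁ c₂
integer-slope⇒sublattice-slope {o} {f₁} {f₂} {A} {N} {c₁} {c₂} basis proper on-lattice (steps , turns) = record
  { x-increasing = λ k k<N → proj₁ (steps k k<N)
  ; y-decreasing = λ k k<N → proj₂ (steps k k<N)
  ; turn≥2 = λ k sk<N → sublattice-turn≥2 {o} {f₁} {f₂} {A} basis proper (point k) (point (suc k)) (point (suc (suc k)))
               (on-lattice k (ℕP.<⇒≤ (ℕP.<⇒≤ sk<N))) (on-lattice (suc k) (ℕP.<⇒≤ sk<N)) (on-lattice (suc (suc k)) sk<N) (turns k sk<N)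
  }
  where
  point : ℕ → ℤ²
  point k = (c₁ k , c₂ k)

lemma6p7 : (o f₁ f₂ : ℤ²) → IsBasis f₁ f₂ →
    (N : ℕ) (v : ℕ → ℤ²) (c₁ c₂ : ℕ → ℤ) →
    (∀ i → i ℕ.≤ N → v i ≡ (o +v (c₁ i • f₁)) +v (c₂ i • f₂)) →
    IsIntegerSlope N c₁ c₂ → Splits N c₁ c₂ →
    (A : Mat2) → ProperSublattice A → (∀ i → i ℕ.≤ N → v i ∈Lat A) →
    + 1 ≤ π̂E N c₁ c₂
lemma6p7 o f₁ f₂ basis N v c₁ c₂ v≡frame slope splits@(x₀<0 , 0<y₀ , 0<x_N , y_N<0 , _) A proper v∈A
  with splitting-edge slope splits
... | j , j<N , 0<x , 0<y , 0<cross =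
  ℤP.i<j⇒suc[i]≤j (subst (+ 0 <_) (sym (π̂E≡excess {N} {c₁} {c₂} x₀<0 0<y₀ 0<x_N y_N<0))
    (excess-pos sublattice j<N 0<x 0<y x₀<0 y_N<0 0<cross))
  where
  sublattice : SublatticeSlope N c₁ c₂
  sublattice = integer-slope⇒sublattice-slope {o} {f₁} {f₂} {A} basis proper
                 (λ k k≤N → subst (_∈Lat A) (v≡frame k k≤N) (v∈A k k≤N)) slope
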